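{- Let $\Sigma$ be an alphabet with involution. Let $u_1,\dots,u_n,p$ ($n\ge1$) be reduced words over $\Sigma$ with $p\neq1$, and let $w$ be the unique reduced word equal to $u_1\cdots u_n$ in the group $\mathrm{FG}(\Sigma)$. Then $|\delta_p(w)-\delta_p(u_1)-\cdots-\delta_p(u_n)|\le 3(|p|-1)(n-1)$.
   Context: For a nonempty word $p$ and a word $u$, $|u|_p$ is the number of occurrences of $p$ as a factor of $u$, i.e. $|\{u': u'p \text{ is a prefix of } u\}|$, and $\delta_p(u)=|u|_p-|u|_{\overline p}$, where $\overline{a_1\cdots a_m}=\overline{a_m}\cdots\overline{a_1}$. A word is reduced if it contains no factor $a\overline a$ ($a\in\Sigma$); $\mathrm{FG}(\Sigma)=\Sigma^*/\{a\overline a=1\}$ is identified with the set of reduced words. -}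

module Defs where

open import Data.Bool using (Bool; true; false; _∧_; if_then_else_)
open import Data.Nat using (ℕ; zero; suc; _+_)
open import Data.Integer as ℤ using (ℤ; +_; _-_)
open import Data.List using (List; []; _∷_; _++_; map; reverse; concat)
open import Data.Vec using (Vec; toList)
open import Relation.Binary.PropositionalEquality using (_≡_)
open import Relation.Binary.Definitions using (DecidableEquality)
open import Relation.Binary.Construct.Closure.Equivalence using (EqClosure)
open import Relation.Nullary using (¬_; does)

record AlphabetWithInvolution : Set₁ where
  field
    Carrier       : Set
    _≟_           : DecidableEquality Carrier
    inv           : Carrier → Carrier
    inv-involutive : ∀ a → inv (inv a) ≡ a

module _ (A : AlphabetWithInvolution) where
  open AlphabetWithInvolution A

  Word : Set
  Word = List Carrier

  bar : Word → Word
  bar w = reverse (map inv w)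

  isPrefix : Word → Word → Bool
  isPrefix [] u = true
  isPrefix (a ∷ p) [] = false
  isPrefix (a ∷ p) (b ∷ u) = does (a ≟ b) ∧ isPrefix p u

  -- |u|_p = #{ u' : u' p is a prefix of u } = #{ i ≤ |u| : p is a prefix of drop i u }
  occ : Word → Word → ℕ
  occ p [] = if isPrefix p [] then 1 else 0
  occ p (b ∷ u) = (if isPrefix p (b ∷ u) then 1 else 0) + occ p u

  δ : Word → Word → ℤ
  δ p u = + occ p u - + occ (bar p) u

  Reduced : Word → Set
  Reduced u = ∀ (xs ys : Word) (a : Carrier) → ¬ (u ≡ xs ++ a ∷ inv a ∷ ys)

  data Cancel : Word → Word → Set where
    cancel : ∀ (xs ys : Word) (a : Carrier) → Cancel (xs ++ a ∷ inv a ∷ ys) (xs ++ ys)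

  -- equality in FG(Σ) = Σ* / {a ā = 1}: the equivalence closure of Cancel
  -- (a congruence, since Cancel is closed under left/right multiplication)
  _≈FG_ : Word → Word → Set
  _≈FG_ = EqClosure Cancel

  sumδ : Word → List Word → ℤ
  sumδ p [] = + 0
  sumδ p (u ∷ us) = δ p u ℤ.+ sumδ p us

module Submission where

-- Freely reduce u₁⋯uₙ by pushing the letters of each uᵢ, right to left, onto
-- the already reduced word r of uᵢ₊₁⋯uₙ.  Since uᵢ is reduced, this cancels a
-- suffix y of uᵢ = x y against a prefix ȳ of r = ȳ z and leaves x z.
-- Occurrences of p in a concatenation s t are those of s and of t plus at most
-- |p| - 1 straddling the cut, and δ_p(ȳ) = -δ_p(y); so each of the n - 1 steps
-- incurs an error |δ_p(x z) - δ_p(x y) - δ_p(ȳ z)| of at most 3(|p| - 1).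

open import Defs
open import Data.Bool using (Bool; true; false; _∧_; if_then_else_)
open import Data.Bool.Properties using (∧-zeroʳ)
open import Data.Empty using (⊥-elim)
open import Data.Integer as ℤ using (+_; ∣_∣; _-_)
import Data.Integer.Properties as ℤₚ
import Data.Integer.Tactic.RingSolver as ℤ-Solver
open import Data.List using (List; []; _∷_; _++_; _∷ʳ_; map; reverse; foldr; concat; length)
open import Data.List.Properties
  using ( ≡-dec; foldr-++; ++-identityʳ; ++-assoc; unfold-reverse; reverse-involutive
        ; reverse-injective; reverse-map; length-reverse; length-map; map-∘; map-cong; map-id)
open import Data.List.Relation.Unary.All using (All; _∷_)
open import Data.Nat using (ℕ; suc; _+_; _*_; _∸_; _≤_; _<_; z≤n; s≤s; _≤?_)
import Data.Nat.Properties as ℕₚ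
import Data.Nat.Tactic.RingSolver as ℕ-Solver
open import Data.Product using (∃-syntax; _×_; _,_; proj₁)
open import Data.Unit using (⊤)
open import Function using (_∘_)
open import Function.Bundles using (mk⇔)
open import Relation.Binary.Definitions using (DecidableEquality)
open import Relation.Binary.PropositionalEquality
open import Relation.Binary.Construct.Closure.Symmetric using (fwd; bwd)
open import Relation.Binary.Construct.Closure.ReflexiveTransitive using (ε; _◅_)
open import Relation.Nullary using (¬_; yes; no; does)
open import Relation.Nullary.Decidable using (does-⇔)

module _ (A : AlphabetWithInvolution) where
  open AlphabetWithInvolution A

  push : Carrier → Word A → Word A
  push a []      = a ∷ []
  push a (b ∷ s) with b ≟ inv a
  ... | yes _ = s
  ... | no  _ = a ∷ b ∷ s

  reduce : Word A → Word A
  reduce = foldr push []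

  Reduced′ : Word A → Set
  Reduced′ []          = ⊤
  Reduced′ (a ∷ [])    = ⊤
  Reduced′ (a ∷ b ∷ s) = b ≢ inv a × Reduced′ (b ∷ s)

  Reduced′-tail : ∀ {a} s → Reduced′ (a ∷ s) → Reduced′ s
  Reduced′-tail []      _       = _
  Reduced′-tail (_ ∷ _) (_ , r) = r

  Reduced⇒Reduced′ : ∀ u → Reduced A u → Reduced′ u
  Reduced⇒Reduced′ []          _ = _
  Reduced⇒Reduced′ (a ∷ [])    _ = _
  Reduced⇒Reduced′ (a ∷ b ∷ s) r =
    (λ b≡ā → r [] s a (cong (λ c → a ∷ c ∷ s) b≡ā)) ,
    Reduced⇒Reduced′ (b ∷ s) (λ xs ys c eq → r (a ∷ xs) ys c (cong (a ∷_) eq))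

  push-Reduced′ : ∀ a s → Reduced′ s → Reduced′ (push a s)
  push-Reduced′ a []      _ = _
  push-Reduced′ a (b ∷ s) r with b ≟ inv a
  ... | yes _   = Reduced′-tail s r
  ... | no  b≢ā = b≢ā , r

  reduce-Reduced′ : ∀ s → Reduced′ (reduce s)
  reduce-Reduced′ []      = _
  reduce-Reduced′ (a ∷ s) = push-Reduced′ a (reduce s) (reduce-Reduced′ s)

  push-Reduced′-∷ : ∀ a s → Reduced′ (a ∷ s) → push a s ≡ a ∷ s
  push-Reduced′-∷ a []      _         = refl
  push-Reduced′-∷ a (b ∷ s) (b≢ā , _) with b ≟ inv a
  ... | yes b≡ā = ⊥-elim (b≢ā b≡ā)
  ... | no  _   = refl

  reduce-id : ∀ s → Reduced′ s → reduce s ≡ s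
  reduce-id []      _ = refl
  reduce-id (a ∷ s) r =
    trans (cong (push a) (reduce-id s (Reduced′-tail s r))) (push-Reduced′-∷ a s r)

  push-inv-∷ : ∀ a s → push a (inv a ∷ s) ≡ s
  push-inv-∷ a s with inv a ≟ inv a
  ... | yes _    = refl
  ... | no  ā≢ā = ⊥-elim (ā≢ā refl)

  push-push-inv : ∀ a s → Reduced′ s → push a (push (inv a) s) ≡ s
  push-push-inv a []      _ = push-inv-∷ a []
  push-push-inv a (b ∷ s) r with b ≟ inv (inv a)
  ... | yes b≡a with refl ← trans b≡a (inv-involutive a) = push-Reduced′-∷ b s r
  ... | no  _ = push-inv-∷ a (b ∷ s)

  reduce-++ : ∀ xs ys → reduce (xs ++ ys) ≡ foldr push (reduce ys) xs
  reduce-++ = foldr-++ push []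

  Cancel⇒reduce-≡ : ∀ {u v} → Cancel A u v → reduce u ≡ reduce v
  Cancel⇒reduce-≡ (cancel xs ys a) = begin
    reduce (xs ++ a ∷ inv a ∷ ys)                     ≡⟨ reduce-++ xs (a ∷ inv a ∷ ys) ⟩
    foldr push (push a (push (inv a) (reduce ys))) xs ≡⟨ cong (λ r → foldr push r xs)
                                                           (push-push-inv a (reduce ys) (reduce-Reduced′ ys)) ⟩
    foldr push (reduce ys) xs                         ≡⟨ reduce-++ xs ys ⟨
    reduce (xs ++ ys)                                 ∎
    where open ≡-Reasoning

  ≈FG⇒reduce-≡ : ∀ {u v} → _≈FG_ A u v → reduce u ≡ reduce v
  ≈FG⇒reduce-≡ ε             = refl
  ≈FG⇒reduce-≡ (fwd c ◅ u≈v) = trans (Cancel⇒reduce-≡ c) (≈FG⇒reduce-≡ u≈v)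
  ≈FG⇒reduce-≡ (bwd c ◅ u≈v) = trans (sym (Cancel⇒reduce-≡ c)) (≈FG⇒reduce-≡ u≈v)

  data Cancellation : Word A → Word A → Word A → Set where
    cancellation : ∀ x y z → Cancellation (x ++ y) (bar A y ++ z) (x ++ z)

  push-Cancellation : ∀ {a u r s} → Reduced′ (a ∷ u) → Cancellation u r s →
                      Cancellation (a ∷ u) r (push a s)
  push-Cancellation {a} r (cancellation (b ∷ x) y z) with b ≟ inv a
  ... | yes b≡ā = ⊥-elim (proj₁ r b≡ā)
  ... | no  _   = cancellation (a ∷ b ∷ x) y z
  push-Cancellation {a} _ (cancellation [] y []) = cancellation (a ∷ []) y []
  push-Cancellation {a} _ (cancellation [] y (b ∷ z)) with b ≟ inv a
  ... | yes refl = subst (λ r → Cancellation (a ∷ y) r z) bar-∷-++ (cancellation [] (a ∷ y) z)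
    where
    bar-∷-++ : bar A (a ∷ y) ++ z ≡ bar A y ++ inv a ∷ z
    bar-∷-++ = trans (cong (_++ z) (unfold-reverse (inv a) (map inv y)))
                     (++-assoc (bar A y) (inv a ∷ []) z)
  ... | no  _    = cancellation (a ∷ []) y (b ∷ z)

  foldr-push-Cancellation : ∀ u r → Reduced′ u → Cancellation u r (foldr push r u)
  foldr-push-Cancellation []      r _ = cancellation [] [] r
  foldr-push-Cancellation (a ∷ u) r ru =
    push-Cancellation ru (foldr-push-Cancellation u r (Reduced′-tail u ru))

  indicator : Bool → ℕ
  indicator b = if b then 1 else 0

  indicator≤1 : ∀ b → indicator b ≤ 1
  indicator≤1 true  = s≤s z≤n
  indicator≤1 false = z≤n

  isPrefix-longer : ∀ p v → length v < length p → isPrefix A p v ≡ false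
  isPrefix-longer (d ∷ p) []      _        = refl
  isPrefix-longer (d ∷ p) (b ∷ v) (s≤s lt) =
    trans (cong (does (d ≟ b) ∧_) (isPrefix-longer p v lt)) (∧-zeroʳ _)

  isPrefix-++ : ∀ p v t → length p ≤ length v → isPrefix A p (v ++ t) ≡ isPrefix A p v
  isPrefix-++ []      v       t _         = refl
  isPrefix-++ (d ∷ p) (b ∷ v) t (s≤s p≤v) = cong (does (d ≟ b) ∧_) (isPrefix-++ p v t p≤v)

  -- e counts the occurrences in s t that start in s and end in t.
  occ-++ : ∀ p → p ≢ [] → ∀ s t → ∃[ e ] e ≤ length s × e ≤ length p ∸ 1
           × occ A p (s ++ t) ≡ occ A p s + occ A p t + e
  occ-++ []      p≢[] _       _ = ⊥-elim (p≢[] refl)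
  occ-++ (d ∷ q) _    []      t = 0 , z≤n , z≤n , sym (ℕₚ.+-identityʳ _)
  occ-++ p@(d ∷ q) p≢[] (b ∷ s) t with occ-++ p p≢[] s t | length p ≤? length (b ∷ s)
  ... | e , e≤s , e≤k , eq | yes p≤bs = e , ℕₚ.m≤n⇒m≤1+n e≤s , e≤k , (begin
    indicator (isPrefix A p (b ∷ s ++ t)) + occ A p (s ++ t)
      ≡⟨ cong₂ _+_ (cong indicator (isPrefix-++ p (b ∷ s) t p≤bs)) eq ⟩
    indicator (isPrefix A p (b ∷ s)) + (occ A p s + occ A p t + e)
      ≡⟨ reassoc (indicator (isPrefix A p (b ∷ s))) (occ A p s) (occ A p t) e ⟩
    indicator (isPrefix A p (b ∷ s)) + occ A p s + occ A p t + e ∎)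
    where
    open ≡-Reasoning
    reassoc : ∀ i m n e → i + (m + n + e) ≡ i + m + n + e
    reassoc = ℕ-Solver.solve-∀
  ... | e , e≤s , e≤k , eq | no p≰bs = i + e , i+e≤1+s , ℕₚ.≤-trans i+e≤1+s 1+s≤k , (begin
    i + occ A p (s ++ t)                                   ≡⟨ cong (λ n → i + n) eq ⟩
    i + (occ A p s + occ A p t + e)                        ≡⟨ shift i (occ A p s) (occ A p t) e ⟩
    occ A p s + occ A p t + (i + e)                        ≡⟨ cong (λ c → indicator c + occ A p s + occ A p t + (i + e))
                                                                (isPrefix-longer p (b ∷ s) (ℕₚ.≰⇒> p≰bs)) ⟨
    indicator (isPrefix A p (b ∷ s)) + occ A p s + occ A p t + (i + e) ∎)
    where
    open ≡-Reasoning
    i = indicator (isPrefix A p (b ∷ s ++ t))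
    i+e≤1+s : i + e ≤ suc (length s)
    i+e≤1+s = ℕₚ.+-mono-≤ (indicator≤1 _) e≤s
    1+s≤k : suc (length s) ≤ length q
    1+s≤k with ℕₚ.≰⇒> p≰bs
    ... | s≤s lt = lt
    shift : ∀ i m n e → i + (m + n + e) ≡ m + n + (i + e)
    shift = ℕ-Solver.solve-∀

  infix 4 _≟ʷ_
  _≟ʷ_ : DecidableEquality (Word A)
  _≟ʷ_ = ≡-dec _≟_

  does-≟ʷ-reverse : ∀ x y → does (reverse x ≟ʷ reverse y) ≡ does (x ≟ʷ y)
  does-≟ʷ-reverse x y = does-⇔ (mk⇔ reverse-injective (cong reverse)) (reverse x ≟ʷ reverse y) (x ≟ʷ y)

  does-≟-inv : ∀ d b → does (d ≟ inv b) ≡ does (inv d ≟ b)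
  does-≟-inv d b = does-⇔ (mk⇔ (λ e → trans (cong inv e) (inv-involutive b))
                                (λ e → trans (sym (inv-involutive d)) (cong inv e)))
                           (d ≟ inv b) (inv d ≟ b)

  isPrefix-∷ʳ : ∀ p w c → indicator (isPrefix A p (w ∷ʳ c))
                          ≡ indicator (isPrefix A p w) + indicator (does (p ≟ʷ w ∷ʳ c))
  isPrefix-∷ʳ []          []      c = refl
  isPrefix-∷ʳ []          (_ ∷ _) c = refl
  isPrefix-∷ʳ (d ∷ [])    []      c = refl
  isPrefix-∷ʳ (d ∷ _ ∷ _) []      c = refl
  isPrefix-∷ʳ (d ∷ q)     (b ∷ w) c with d ≟ b
  ... | yes _ = isPrefix-∷ʳ q w c
  ... | no  _ = refl

  isPrefix-reverse-short : ∀ p v → length v ≤ 1 → isPrefix A (reverse p) v ≡ isPrefix A p v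
  isPrefix-reverse-short []            v _   = refl
  isPrefix-reverse-short (d ∷ [])      v _   = refl
  isPrefix-reverse-short p@(d ∷ e ∷ q) v v≤1 =
    trans (isPrefix-longer (reverse p) v (subst (length v <_) (sym (length-reverse p)) v<p))
          (sym (isPrefix-longer p v v<p))
    where
    v<p : length v < length p
    v<p = s≤s (ℕₚ.≤-trans v≤1 (s≤s z≤n))

  isPrefix-map-inv : ∀ q v → isPrefix A q (map inv v) ≡ isPrefix A (map inv q) v
  isPrefix-map-inv []      v       = refl
  isPrefix-map-inv (d ∷ q) []      = refl
  isPrefix-map-inv (d ∷ q) (b ∷ v) = cong₂ _∧_ (does-≟-inv d b) (isPrefix-map-inv q v)

  isSuffix : Word A → Word A → Bool
  isSuffix p w = isPrefix A (reverse p) (reverse w)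

  isSuffix-∷ : ∀ p b w → indicator (isSuffix p (b ∷ w))
                         ≡ indicator (isSuffix p w) + indicator (does (p ≟ʷ b ∷ w))
  isSuffix-∷ p b w = begin
    indicator (isPrefix A (reverse p) (reverse (b ∷ w)))
      ≡⟨ cong (indicator ∘ isPrefix A (reverse p)) (unfold-reverse b w) ⟩
    indicator (isPrefix A (reverse p) (reverse w ∷ʳ b))
      ≡⟨ isPrefix-∷ʳ (reverse p) (reverse w) b ⟩
    indicator (isSuffix p w) + indicator (does (reverse p ≟ʷ reverse w ∷ʳ b))
      ≡⟨ cong (λ v → indicator (isSuffix p w) + indicator (does (reverse p ≟ʷ v))) (unfold-reverse b w) ⟨
    indicator (isSuffix p w) + indicator (does (reverse p ≟ʷ reverse (b ∷ w)))
      ≡⟨ cong (λ x → indicator (isSuffix p w) + indicator x) (does-≟ʷ-reverse p (b ∷ w)) ⟩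
    indicator (isSuffix p w) + indicator (does (p ≟ʷ b ∷ w)) ∎
    where open ≡-Reasoning

  occ-∷ʳ : ∀ p v c → occ A p (v ∷ʳ c) ≡ occ A p v + indicator (isSuffix p (v ∷ʳ c))
  occ-∷ʳ p [] c =
    trans (cong (λ x → indicator x + occ A p [])
                (sym (isPrefix-reverse-short p (c ∷ []) ℕₚ.≤-refl)))
          (ℕₚ.+-comm _ (occ A p []))
  occ-∷ʳ p (b ∷ v) c = begin
    indicator (isPrefix A p (b ∷ v ∷ʳ c)) + occ A p (v ∷ʳ c)
      ≡⟨ cong₂ _+_ (isPrefix-∷ʳ p (b ∷ v) c) (occ-∷ʳ p v c) ⟩
    indicator (isPrefix A p (b ∷ v)) + ended + (occ A p v + indicator (isSuffix p (v ∷ʳ c)))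
      ≡⟨ regroup (indicator (isPrefix A p (b ∷ v))) ended (occ A p v) _ ⟩
    indicator (isPrefix A p (b ∷ v)) + occ A p v + (indicator (isSuffix p (v ∷ʳ c)) + ended)
      ≡⟨ cong (λ n → indicator (isPrefix A p (b ∷ v)) + occ A p v + n) (isSuffix-∷ p b (v ∷ʳ c)) ⟨
    indicator (isPrefix A p (b ∷ v)) + occ A p v + indicator (isSuffix p (b ∷ v ∷ʳ c)) ∎
    where
    open ≡-Reasoning
    ended = indicator (does (p ≟ʷ b ∷ v ∷ʳ c))
    regroup : ∀ i j m n → i + j + (m + n) ≡ i + m + (n + j)
    regroup = ℕ-Solver.solve-∀

  occ-reverse : ∀ p u → occ A p (reverse u) ≡ occ A (reverse p) u
  occ-reverse p []      = cong indicator (sym (isPrefix-reverse-short p [] z≤n))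
  occ-reverse p (a ∷ s) = begin
    occ A p (reverse (a ∷ s))
      ≡⟨ cong (occ A p) (unfold-reverse a s) ⟩
    occ A p (reverse s ∷ʳ a)
      ≡⟨ occ-∷ʳ p (reverse s) a ⟩
    occ A p (reverse s) + indicator (isPrefix A (reverse p) (reverse (reverse s ∷ʳ a)))
      ≡⟨ cong₂ _+_ (occ-reverse p s) (cong (indicator ∘ isPrefix A (reverse p)) reverse-reverse-∷ʳ) ⟩
    occ A (reverse p) s + indicator (isPrefix A (reverse p) (a ∷ s))
      ≡⟨ ℕₚ.+-comm (occ A (reverse p) s) _ ⟩
    occ A (reverse p) (a ∷ s) ∎
    where
    open ≡-Reasoning
    reverse-reverse-∷ʳ : reverse (reverse s ∷ʳ a) ≡ a ∷ s
    reverse-reverse-∷ʳ = trans (cong reverse (sym (unfold-reverse a s))) (reverse-involutive (a ∷ s))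

  occ-map-inv : ∀ p u → occ A p (map inv u) ≡ occ A (map inv p) u
  occ-map-inv p []      = cong indicator (isPrefix-map-inv p [])
  occ-map-inv p (a ∷ u) = cong₂ _+_ (cong indicator (isPrefix-map-inv p (a ∷ u))) (occ-map-inv p u)

  occ-bar : ∀ p u → occ A p (bar A u) ≡ occ A (bar A p) u
  occ-bar p u = trans (occ-reverse p (map inv u))
                      (trans (occ-map-inv (reverse p) u) (cong (λ q → occ A q u) (reverse-map inv p)))

  bar-involutive : ∀ p → bar A (bar A p) ≡ p
  bar-involutive p = begin
    reverse (map inv (reverse (map inv p))) ≡⟨ cong reverse (reverse-map inv (map inv p)) ⟩
    reverse (reverse (map inv (map inv p))) ≡⟨ reverse-involutive _ ⟩
    map inv (map inv p)                     ≡⟨ map-∘ p ⟨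
    map (inv ∘ inv) p                       ≡⟨ map-cong inv-involutive p ⟩
    map (λ a → a) p                         ≡⟨ map-id p ⟩
    p                                       ∎
    where open ≡-Reasoning

  bar-≢[] : ∀ {p} → p ≢ [] → bar A p ≢ []
  bar-≢[] {p} p≢[] eq = p≢[] (trans (sym (bar-involutive p)) (cong (bar A) eq))

  length-bar : ∀ p → length (bar A p) ≡ length p
  length-bar p = trans (length-reverse (map inv p)) (length-map inv p)

  δ-bar : ∀ p s → δ A p (bar A s) ≡ ℤ.- δ A p s
  δ-bar p s = begin
    + occ A p (bar A s) - + occ A (bar A p) (bar A s)
      ≡⟨ cong₂ (λ m n → + m - + n) (occ-bar p s) (occ-bar (bar A p) s) ⟩
    + occ A (bar A p) s - + occ A (bar A (bar A p)) s
      ≡⟨ cong (λ q → + occ A (bar A p) s - + occ A q s) (bar-involutive p) ⟩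
    + occ A (bar A p) s - + occ A p s
      ≡⟨ swap (+ occ A (bar A p) s) (+ occ A p s) ⟩
    ℤ.- δ A p s ∎
    where
    open ≡-Reasoning
    swap : ∀ i j → i - j ≡ ℤ.- (j - i)
    swap = ℤ-Solver.solve-∀

  δ-++ : ∀ p → p ≢ [] → ∀ s t → ∃[ η ] ∣ η ∣ ≤ length p ∸ 1
         × δ A p (s ++ t) ≡ δ A p s ℤ.+ δ A p t ℤ.+ η
  δ-++ p p≢[] s t with occ-++ p p≢[] s t | occ-++ (bar A p) (bar-≢[] p≢[]) s t
  ... | e , _ , e≤k , eq | f , _ , f≤k , eq′ = + e - + f , ∣e-f∣≤k , (begin
    + occ A p (s ++ t) - + occ A (bar A p) (s ++ t)
      ≡⟨ cong₂ (λ m n → + m - + n) eq eq′ ⟩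
    + (occ A p s + occ A p t + e) - + (occ A (bar A p) s + occ A (bar A p) t + f)
      ≡⟨ cong₂ _-_ (pos-+³ (occ A p s) (occ A p t) e) (pos-+³ (occ A (bar A p) s) (occ A (bar A p) t) f) ⟩
    (+ occ A p s ℤ.+ + occ A p t ℤ.+ + e) - (+ occ A (bar A p) s ℤ.+ + occ A (bar A p) t ℤ.+ + f)
      ≡⟨ regroup (+ occ A p s) (+ occ A p t) (+ e) (+ occ A (bar A p) s) (+ occ A (bar A p) t) (+ f) ⟩
    δ A p s ℤ.+ δ A p t ℤ.+ (+ e - + f) ∎)
    where
    open ≡-Reasoning
    ∣e-f∣≤k : ∣ + e - + f ∣ ≤ length p ∸ 1
    ∣e-f∣≤k = ℕₚ.≤-trans (ℕₚ.≤-reflexive (cong ∣_∣ (ℤₚ.m-n≡m⊖n e f)))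
                (ℕₚ.≤-trans (ℤₚ.∣m⊝n∣≤m⊔n e f)
                  (ℕₚ.⊔-lub e≤k (subst (λ n → f ≤ n ∸ 1) (length-bar p) f≤k)))
    pos-+³ : ∀ a b c → + (a + b + c) ≡ + a ℤ.+ + b ℤ.+ + c
    pos-+³ a b c = trans (ℤₚ.pos-+ (a + b) c) (cong (ℤ._+ + c) (ℤₚ.pos-+ a b))
    regroup : ∀ a b e c d f → (a ℤ.+ b ℤ.+ e) - (c ℤ.+ d ℤ.+ f) ≡ (a - c) ℤ.+ (b - d) ℤ.+ (e - f)
    regroup = ℤ-Solver.solve-∀

  δ-Cancellation : ∀ p → p ≢ [] → ∀ {u r ur} → Cancellation u r ur →
                   ∣ δ A p ur - (δ A p u ℤ.+ δ A p r) ∣ ≤ 3 * (length p ∸ 1)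
  δ-Cancellation p p≢[] (cancellation x y z)
    with δ-++ p p≢[] x z | δ-++ p p≢[] x y | δ-++ p p≢[] (bar A y) z
  ... | η₁ , ∣η₁∣≤k , eq₁ | η₂ , ∣η₂∣≤k , eq₂ | η₃ , ∣η₃∣≤k , eq₃ = begin
    ∣ δ A p (x ++ z) - (δ A p (x ++ y) ℤ.+ δ A p (bar A y ++ z)) ∣ ≡⟨ cong ∣_∣ error-identity ⟩
    ∣ η₁ - (η₂ ℤ.+ η₃) ∣                                            ≤⟨ ℤₚ.∣i-j∣≤∣i∣+∣j∣ η₁ _ ⟩
    ∣ η₁ ∣ + ∣ η₂ ℤ.+ η₃ ∣                                           ≤⟨ ℕₚ.+-mono-≤ ∣η₁∣≤k ∣η₂+η₃∣≤2k ⟩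
    k + (k + k)                                                     ≡⟨ triple k ⟩
    3 * k                                                           ∎
    where
    open ℕₚ.≤-Reasoning
    k = length p ∸ 1
    X = δ A p x ; Y = δ A p y ; Z = δ A p z

    ∣η₂+η₃∣≤2k : ∣ η₂ ℤ.+ η₃ ∣ ≤ k + k
    ∣η₂+η₃∣≤2k = ℕₚ.≤-trans (ℤₚ.∣i+j∣≤∣i∣+∣j∣ η₂ η₃) (ℕₚ.+-mono-≤ ∣η₂∣≤k ∣η₃∣≤k)

    error-identity : δ A p (x ++ z) - (δ A p (x ++ y) ℤ.+ δ A p (bar A y ++ z)) ≡ η₁ - (η₂ ℤ.+ η₃)
    error-identity = trans
      (cong₂ (λ m n → m - n) eq₁ (cong₂ ℤ._+_ eq₂ (trans eq₃ (cong (λ d → d ℤ.+ Z ℤ.+ η₃) (δ-bar p y)))))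
      (cancel-δ X Y Z η₁ η₂ η₃)
      where
      cancel-δ : ∀ X Y Z a b c → (X ℤ.+ Z ℤ.+ a) - ((X ℤ.+ Y ℤ.+ b) ℤ.+ (ℤ.- Y ℤ.+ Z ℤ.+ c)) ≡ a - (b ℤ.+ c)
      cancel-δ = ℤ-Solver.solve-∀

    triple : ∀ k → k + (k + k) ≡ 3 * k
    triple = ℕ-Solver.solve-∀

  δ-reduce-concat : ∀ p → p ≢ [] → ∀ u us → All (Reduced A) (u ∷ us) →
    ∣ δ A p (reduce (concat (u ∷ us))) - sumδ A p (u ∷ us) ∣ ≤ 3 * (length p ∸ 1) * length us
  δ-reduce-concat p _ u [] (u-red ∷ _) = subst (_≤ 3 * (length p ∸ 1) * 0) (sym (cong ∣_∣ vanishes)) z≤n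
    where
    open ≡-Reasoning
    vanishes : δ A p (reduce (u ++ [])) - (δ A p u ℤ.+ + 0) ≡ + 0
    vanishes = begin
      δ A p (reduce (u ++ [])) - (δ A p u ℤ.+ + 0)
        ≡⟨ cong (λ v → δ A p v - (δ A p u ℤ.+ + 0))
             (trans (cong reduce (++-identityʳ u)) (reduce-id u (Reduced⇒Reduced′ u u-red))) ⟩
      δ A p u - (δ A p u ℤ.+ + 0)
        ≡⟨ self-minus (δ A p u) ⟩
      + 0 ∎
      where
      self-minus : ∀ i → i - (i ℤ.+ + 0) ≡ + 0
      self-minus = ℤ-Solver.solve-∀
  δ-reduce-concat p p≢[] u (v ∷ us) (u-red ∷ us-red) = begin
    ∣ δ A p (reduce (u ++ concat (v ∷ us))) - (δ A p u ℤ.+ S) ∣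
      ≡⟨ cong (λ t → ∣ δ A p t - (δ A p u ℤ.+ S) ∣) (reduce-++ u (concat (v ∷ us))) ⟩
    ∣ δ A p (foldr push r u) - (δ A p u ℤ.+ S) ∣
      ≡⟨ cong ∣_∣ (split (δ A p (foldr push r u)) (δ A p u) (δ A p r) S) ⟩
    ∣ (δ A p (foldr push r u) - (δ A p u ℤ.+ δ A p r)) ℤ.+ (δ A p r - S) ∣
      ≤⟨ ℤₚ.∣i+j∣≤∣i∣+∣j∣ (δ A p (foldr push r u) - (δ A p u ℤ.+ δ A p r)) (δ A p r - S) ⟩
    ∣ δ A p (foldr push r u) - (δ A p u ℤ.+ δ A p r) ∣ + ∣ δ A p r - S ∣
      ≤⟨ ℕₚ.+-mono-≤ (δ-Cancellation p p≢[] (foldr-push-Cancellation u r (Reduced⇒Reduced′ u u-red)))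
                     (δ-reduce-concat p p≢[] v us us-red) ⟩
    3 * k + 3 * k * length us
      ≡⟨ distrib k (length us) ⟩
    3 * k * suc (length us) ∎
    where
    open ℕₚ.≤-Reasoning
    k = length p ∸ 1
    r = reduce (concat (v ∷ us))
    S = sumδ A p (v ∷ us)
    split : ∀ X U R S → X - (U ℤ.+ S) ≡ (X - (U ℤ.+ R)) ℤ.+ (R - S)
    split = ℤ-Solver.solve-∀
    distrib : ∀ k m → 3 * k + 3 * k * m ≡ 3 * k * suc m
    distrib = ℕ-Solver.solve-∀

lemma6p1 : (A : AlphabetWithInvolution) (n : ℕ) (us : List (Word A)) (p w : Word A)
    → length us ≡ n → 1 ≤ n
    → All (Reduced A) us → Reduced A p → ¬ (p ≡ [])
    → Reduced A w → _≈FG_ A w (concat us)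
    → ∣ δ A p w - sumδ A p us ∣ ≤ 3 * (length p ∸ 1) * (n ∸ 1)
lemma6p1 A _ []       _ _ refl () _ _ _ _ _
lemma6p1 A _ (u ∷ us) p w refl _ us-red _ p≢[] w-red w≈us =
  subst (λ v → ∣ δ A p v - sumδ A p (u ∷ us) ∣ ≤ 3 * (length p ∸ 1) * length us)
        (sym w≡reduce) (δ-reduce-concat A p p≢[] u us us-red)
  where
  w≡reduce : w ≡ reduce A (concat (u ∷ us))
  w≡reduce = trans (sym (reduce-id A w (Reduced⇒Reduced′ A w w-red))) (≈FG⇒reduce-≡ A w≈us)
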